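{- Let $G=(V,E)$ be a proper max-point-tolerance graph. Then there is a linear ordering $<$ of $V$ satisfying: (1) for all $v_1<v_2<v_3$ in $V$: if $v_1v_3\in E$ then $v_1v_2\in E$ or $v_2v_3\in E$; (2) for all $v_1<v_2<v_3<v_4<v_5$ in $V$: if $v_1v_4\in E$, $v_2v_5\in E$, and ($v_1v_2\in E$ or $v_4v_5\in E$), then $v_1v_3\in E$ or $v_3v_5\in E$; (3) for all $v_1<v_2<v_3<v_4<v_5$ in $V$: if $v_1v_3\in E$ and $v_3v_5\in E$ then $v_1v_2\in E$ or $v_2v_4\in E$ or $v_4v_5\in E$; (4) for all $v_1,v_2,v_j,v_k,v_5,v_6\in V$ with $v_1<v_2<v_j<v_5<v_6$ and $v_2<v_k<v_5$: if $v_1v_j,\ v_jv_5,\ v_2v_k,\ v_kv_6\in E$ then $v_1v_2\in E$ or $v_2v_5\in E$ or $v_5v_6\in E$.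
   Context: $G=(V,E)$ (finite, simple, undirected) is a max-point-tolerance graph (MPTG) if each vertex $u$ can be assigned a pair $(I_u,p_u)$, with $I_u$ a closed bounded real interval and $p_u\in I_u$, such that for distinct $u,v$, $uv\in E$ iff $\{p_u,p_v\}\subseteq I_u\cap I_v$. It is a proper MPTG if it has such a representation in which no interval properly contains another.
   Formalization: The intervals $I_u$ have rational endpoints and the points $p_u$ are rational, rather than real, in the proper max-point-tolerance representation. -}

module Defs where

open import Data.Nat using (ℕ)
open import Data.Fin using (Fin)
import Data.Fin as F
open import Data.Rational using (ℚ; _≤_)
open import Data.Product using (_×_; _,_; Σ-syntax; proj₁)
open import Data.Sum using (_⊎_)
open import Relation.Nullary using (¬_)
open import Relation.Binary.PropositionalEquality using (_≡_; _≢_)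
open import Function.Definitions using (Injective)

record Graph (n : ℕ) : Set₁ where
  field
    E     : Fin n → Fin n → Set
    sym   : ∀ {u v} → E u v → E v u
    irrefl : ∀ {u} → ¬ E u u
open Graph public

record Interval : Set where
  constructor [_,_]⟨_⟩
  field
    lo : ℚ
    hi : ℚ
    lo≤hi : lo ≤ hi
open Interval public

_∈I_ : ℚ → Interval → Set
x ∈I I = lo I ≤ x × x ≤ hi I

_∈∩_,_ : ℚ → Interval → Interval → Set
x ∈∩ I , J = x ∈I I × x ∈I J

_⊆I_ : Interval → Interval → Set
I ⊆I J = ∀ x → x ∈I I → x ∈I J

_⊂I_ : Interval → Interval → Set
I ⊂I J = I ⊆I J × ¬ (J ⊆I I)

record MPTRep {n : ℕ} (G : Graph n) : Set where
  field
    I   : Fin n → Interval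
    p   : Fin n → ℚ
    p∈I : ∀ u → p u ∈I I u
    edge⇒ : ∀ u v → u ≢ v → E G u v →
              (p u ∈∩ I u , I v) × (p v ∈∩ I u , I v)
    ⇒edge : ∀ u v → u ≢ v →
              (p u ∈∩ I u , I v) × (p v ∈∩ I u , I v) → E G u v
open MPTRep public

IsProper : {n : ℕ} {G : Graph n} → MPTRep G → Set
IsProper R = ∀ u v → ¬ (I R u ⊂I I R v)

IsProperMPTG : {n : ℕ} → Graph n → Set
IsProperMPTG G = Σ[ R ∈ MPTRep G ] IsProper R

LinOrd : ℕ → Set
LinOrd n = Σ[ ord ∈ (Fin n → Fin n) ] Injective _≡_ _≡_ ord

Before : {n : ℕ} → LinOrd n → Fin n → Fin n → Set
Before L u v = proj₁ L u F.< proj₁ L v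

module Conditions {n : ℕ} (G : Graph n) (L : LinOrd n) where
  private
    _≺_ : Fin n → Fin n → Set
    u ≺ v = Before L u v
    _~_ : Fin n → Fin n → Set
    u ~ v = E G u v

  Cond1 : Set
  Cond1 = ∀ v₁ v₂ v₃ → v₁ ≺ v₂ → v₂ ≺ v₃ →
          v₁ ~ v₃ → (v₁ ~ v₂) ⊎ (v₂ ~ v₃)

  Cond2 : Set
  Cond2 = ∀ v₁ v₂ v₃ v₄ v₅ → v₁ ≺ v₂ → v₂ ≺ v₃ → v₃ ≺ v₄ → v₄ ≺ v₅ →
          v₁ ~ v₄ → v₂ ~ v₅ → (v₁ ~ v₂) ⊎ (v₄ ~ v₅) →
          (v₁ ~ v₃) ⊎ (v₃ ~ v₅)

  Cond3 : Set
  Cond3 = ∀ v₁ v₂ v₃ v₄ v₅ → v₁ ≺ v₂ → v₂ ≺ v₃ → v₃ ≺ v₄ → v₄ ≺ v₅ →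
          v₁ ~ v₃ → v₃ ~ v₅ →
          (v₁ ~ v₂) ⊎ ((v₂ ~ v₄) ⊎ (v₄ ~ v₅))

  Cond4 : Set
  Cond4 = ∀ v₁ v₂ vj vk v₅ v₆ →
          v₁ ≺ v₂ → v₂ ≺ vj → vj ≺ v₅ → v₅ ≺ v₆ →
          v₂ ≺ vk → vk ≺ v₅ →
          v₁ ~ vj → vj ~ v₅ → v₂ ~ vk → vk ~ v₆ →
          (v₁ ~ v₂) ⊎ ((v₂ ~ v₅) ⊎ (v₅ ~ v₆))

  AllConds : Set
  AllConds = Cond1 × Cond2 × Cond3 × Cond4

{-# OPTIONS --safe #-}
-- Sort the vertices by left endpoint.  In a proper representation the right
-- endpoints are then sorted too, and for u before v adjacency reduces to
-- l v ≤ p u and p v ≤ r u.  Each condition follows by comparing p v₂ with r v₁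
-- (and, at the other end, the last left endpoint with the penultimate point):
-- either an outer edge exists, or the resulting chain of inequalities through
-- the given edges produces the middle edge.
module Submission where

open import Defs
open import Data.Nat using (ℕ)
import Data.Nat as ℕ
open import Data.Fin using (Fin; fromℕ<)
import Data.Fin as F
import Data.Fin.Properties as F
open import Data.Fin.Subset using (Subset; _∈_; _⊂_; ⊤; ∣_∣)
open import Data.Fin.Subset.Properties using (∈⊤; ⊆⊤; ∣⊤∣≡n; p⊂q⇒∣p∣<∣q∣)
open import Data.Vec using (tabulate)
open import Data.Vec.Properties using (lookup∘tabulate; lookup⇒[]=; []=⇒lookup)
open import Data.Bool using (true)
open import Data.Product using (Σ-syntax; _×_; _,_; proj₁; proj₂)
open import Data.Product.Relation.Binary.Lex.Strict using (×-strictTotalOrder)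
open import Data.Rational using (ℚ; _≤_)
import Data.Rational.Properties as ℚ
open import Data.Sum using (_⊎_; inj₁; inj₂; [_,_]′)
import Data.Sum as Sum
open import Function.Base using (_on_; _∘_)
open import Function.Bundles using (_⇔_; mk⇔; Equivalence)
open import Function.Definitions using (Injective)
open import Relation.Binary using (StrictTotalOrder; _⇒_; tri<; tri≈; tri>)
open import Relation.Binary.PropositionalEquality as ≡ using (_≡_; _≢_; refl)
open import Relation.Nullary using (¬_; Dec; yes; no; does; contradiction)
open import Relation.Nullary.Decidable using (dec-true)

module SortByKey {a ℓ₁ ℓ₂} (S : StrictTotalOrder a ℓ₁ ℓ₂) {n : ℕ}
  (key : Fin n → StrictTotalOrder.Carrier S)
  (key-injective : Injective _≡_ (StrictTotalOrder._≈_ S) key) where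

  open StrictTotalOrder S renaming (irrefl to <-irrefl; trans to <-trans)

  below : Fin n → Subset n
  below u = tabulate λ v → does (key v <? key u)

  ∈below⁺ : ∀ {u v} → key v < key u → v ∈ below u
  ∈below⁺ {u} {v} v<u =
    lookup⇒[]= v (below u) (≡.trans (lookup∘tabulate _ v) (dec-true (key v <? key u) v<u))

  ∈below⁻ : ∀ {u v} → v ∈ below u → key v < key u
  ∈below⁻ {u} {v} v∈ =
    does-true⇒ (key v <? key u) (≡.trans (≡.sym (lookup∘tabulate _ v)) ([]=⇒lookup v∈))
    where
    does-true⇒ : ∀ {A : Set ℓ₂} (A? : Dec A) → does A? ≡ true → A
    does-true⇒ (yes a) _  = a
    does-true⇒ (no _)  ()

  u∉below-u : ∀ u → ¬ (u ∈ below u)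
  u∉below-u u u∈ = <-irrefl Eq.refl (∈below⁻ u∈)

  below-⊂ : ∀ {u v} → key u < key v → below u ⊂ below v
  below-⊂ {u} u<v = (λ w∈ → ∈below⁺ (<-trans (∈below⁻ w∈) u<v)) , u , ∈below⁺ u<v , u∉below-u u

  below-⊂⊤ : ∀ u → below u ⊂ ⊤
  below-⊂⊤ u = ⊆⊤ , u , ∈⊤ , u∉below-u u

  rank<n : ∀ u → ∣ below u ∣ ℕ.< n
  rank<n u = ≡.subst (∣ below u ∣ ℕ.<_) (∣⊤∣≡n n) (p⊂q⇒∣p∣<∣q∣ (below-⊂⊤ u))

  position : Fin n → Fin n
  position u = fromℕ< (rank<n u)

  position-mono : ∀ {u v} → key u < key v → position u F.< position v
  position-mono {u} {v} u<v = ≡.subst₂ ℕ._<_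
    (≡.sym (F.toℕ-fromℕ< (rank<n u))) (≡.sym (F.toℕ-fromℕ< (rank<n v)))
    (p⊂q⇒∣p∣<∣q∣ (below-⊂ u<v))

  position-injective : Injective _≡_ _≡_ position
  position-injective {u} {v} eq with compare (key u) (key v)
  ... | tri< u<v _ _ = contradiction (position-mono u<v) (F.<-irrefl eq)
  ... | tri≈ _ u≈v _ = key-injective u≈v
  ... | tri> _ _ v<u = contradiction (position-mono v<u) (F.<-irrefl (≡.sym eq))

  sortedBy : LinOrd n
  sortedBy = position , position-injective

  sortedBy-respects-key : Before sortedBy ⇒ (_<_ on key)
  sortedBy-respects-key {u} {v} u≺v with compare (key u) (key v)
  ... | tri< u<v _ _ = u<v
  ... | tri≈ _ u≈v _ = contradiction u≺v (F.<-irrefl (≡.cong position (key-injective u≈v)))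
  ... | tri> _ _ v<u = contradiction (position-mono v<u) (F.<-asym u≺v)

module _ (I J : Interval) where

  lo≤lo⇒hi≤hi : ¬ (J ⊂I I) → lo I ≤ lo J → hi I ≤ hi J
  lo≤lo⇒hi≤hi J⊄I loI≤loJ with hi I ℚ.≤? hi J
  ... | yes hiI≤hiJ = hiI≤hiJ
  ... | no hiI≰hiJ = contradiction (J⊆I , I⊈J) J⊄I
    where
    J⊆I : J ⊆I I
    J⊆I x (loJ≤x , x≤hiJ) = ℚ.≤-trans loI≤loJ loJ≤x , ℚ.≤-trans x≤hiJ (ℚ.<⇒≤ (ℚ.≰⇒> hiI≰hiJ))

    I⊈J : ¬ (I ⊆I J)
    I⊈J I⊆J = hiI≰hiJ (proj₂ (I⊆J (hi I) (lo≤hi I , ℚ.≤-refl)))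

  points∈∩⇔ : ∀ {x y} → lo I ≤ lo J → hi I ≤ hi J → x ∈I I → y ∈I J →
    (x ∈∩ I , J × y ∈∩ I , J) ⇔ (lo J ≤ x × y ≤ hi I)
  points∈∩⇔ loI≤loJ hiI≤hiJ x∈I@(_ , x≤hiI) y∈J@(loJ≤y , _) = mk⇔
    (λ { ((_ , (loJ≤x , _)) , ((_ , y≤hiI) , _)) → loJ≤x , y≤hiI })
    (λ { (loJ≤x , y≤hiI) →
      (x∈I , (loJ≤x , ℚ.≤-trans x≤hiI hiI≤hiJ)) , ((ℚ.≤-trans loI≤loJ loJ≤y , y≤hiI) , y∈J) })

record EndpointsMonotone {n : ℕ} {G : Graph n} (R : MPTRep G) (L : LinOrd n) : Set where
  field
    lo-mono : ∀ {u v} → Before L u v → lo (I R u) ≤ lo (I R v)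
    hi-mono : ∀ {u v} → Before L u v → hi (I R u) ≤ hi (I R v)

proper⇒endpointsMonotone : {n : ℕ} {G : Graph n} (R : MPTRep G) → IsProper R →
  Σ[ L ∈ LinOrd n ] EndpointsMonotone R L
proper⇒endpointsMonotone {n} R proper = sortedBy , record { lo-mono = lo-mono ; hi-mono = hi-mono }
  where
  open SortByKey (×-strictTotalOrder ℚ.<-strictTotalOrder (F.<-strictTotalOrder n))
    (λ u → lo (I R u) , u) proj₂

  lo-mono : ∀ {u v} → Before sortedBy u v → lo (I R u) ≤ lo (I R v)
  lo-mono u≺v with sortedBy-respects-key u≺v
  ... | inj₁ lo<lo = ℚ.<⇒≤ lo<lo
  ... | inj₂ (lo≡lo , _) = ℚ.≤-reflexive lo≡lo

  hi-mono : ∀ {u v} → Before sortedBy u v → hi (I R u) ≤ hi (I R v)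
  hi-mono {u} {v} u≺v = lo≤lo⇒hi≤hi (I R u) (I R v) (proper v u) (lo-mono u≺v)

module Sweep {n : ℕ} {G : Graph n} (R : MPTRep G) (L : LinOrd n)
  (monotone : EndpointsMonotone R L) where

  open EndpointsMonotone monotone
  open Conditions G L
  open ℚ.≤-Reasoning

  private
    l r : Fin n → ℚ
    l u = lo (I R u)
    r u = hi (I R u)

    _≺_ _~_ : Fin n → Fin n → Set
    _≺_ = Before L
    _~_ = E G

  ≺-trans : ∀ {u v w} → u ≺ v → v ≺ w → u ≺ w
  ≺-trans = F.<-trans

  ≺⇒≢ : ∀ {u v} → u ≺ v → u ≢ v
  ≺⇒≢ u≺u refl = F.<-irrefl refl u≺u

  p≤r : ∀ u → p R u ≤ r u
  p≤r u = proj₂ (p∈I R u)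

  ~⇔ : ∀ {u v} → u ≺ v → u ~ v ⇔ (l v ≤ p R u × p R v ≤ r u)
  ~⇔ {u} {v} u≺v = mk⇔
    (Equivalence.to bounds ∘ edge⇒ R u v (≺⇒≢ u≺v))
    (⇒edge R u v (≺⇒≢ u≺v) ∘ Equivalence.from bounds)
    where
    bounds : (p R u ∈∩ I R u , I R v × p R v ∈∩ I R u , I R v) ⇔ (l v ≤ p R u × p R v ≤ r u)
    bounds = points∈∩⇔ (I R u) (I R v) (lo-mono u≺v) (hi-mono u≺v) (p∈I R u) (p∈I R v)

  ~-bounds : ∀ {u v} → u ≺ v → u ~ v → l v ≤ p R u × p R v ≤ r u
  ~-bounds u≺v = Equivalence.to (~⇔ u≺v)

  ~-intro : ∀ {u v} → u ≺ v → l v ≤ p R u → p R v ≤ r u → u ~ v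
  ~-intro u≺v lv≤pu pv≤ru = Equivalence.from (~⇔ u≺v) (lv≤pu , pv≤ru)

  ~-or-r≤p : ∀ {u v} → u ≺ v → l v ≤ p R u → u ~ v ⊎ r u ≤ p R v
  ~-or-r≤p {u} {v} u≺v lv≤pu = Sum.map₁ (~-intro u≺v lv≤pu) (ℚ.≤-total (p R v) (r u))

  ~-or-p≤l : ∀ {v w} → v ≺ w → p R w ≤ r v → v ~ w ⊎ p R v ≤ l w
  ~-or-p≤l {v} {w} v≺w pw≤rv = Sum.map₁ (λ lw≤pv → ~-intro v≺w lw≤pv pw≤rv) (ℚ.≤-total (l w) (p R v))

  cond1 : Cond1
  cond1 v₁ v₂ v₃ 1≺2 2≺3 1~3 with ~-bounds (≺-trans 1≺2 2≺3) 1~3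
  ... | l₃≤p₁ , p₃≤r₁ = Sum.map₂ 2~3 (~-or-r≤p 1≺2 (ℚ.≤-trans (lo-mono 2≺3) l₃≤p₁))
    where
    2~3 : r v₁ ≤ p R v₂ → v₂ ~ v₃
    2~3 r₁≤p₂ = ~-intro 2≺3
      (begin l v₃ ≤⟨ l₃≤p₁ ⟩ p R v₁ ≤⟨ p≤r v₁ ⟩ r v₁ ≤⟨ r₁≤p₂ ⟩ p R v₂ ∎)
      (ℚ.≤-trans p₃≤r₁ (hi-mono 1≺2))

  cond2 : Cond2
  cond2 v₁ v₂ v₃ v₄ v₅ 1≺2 2≺3 3≺4 4≺5 1~4 2~5 1~2⊎4~5
    with ~-bounds (≺-trans 1≺2 (≺-trans 2≺3 3≺4)) 1~4 | ~-bounds (≺-trans 2≺3 (≺-trans 3≺4 4≺5)) 2~5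
  ... | l₄≤p₁ , p₄≤r₁ | l₅≤p₂ , p₅≤r₂ =
    Sum.map₂ 3~5 (~-or-r≤p (≺-trans 1≺2 2≺3) (ℚ.≤-trans (lo-mono 3≺4) l₄≤p₁))
    where
    l₅≤r₁ : l v₅ ≤ r v₁
    l₅≤r₁ = [ (λ 1~2 → ℚ.≤-trans l₅≤p₂ (proj₂ (~-bounds 1≺2 1~2)))
            , (λ 4~5 → ℚ.≤-trans (proj₁ (~-bounds 4≺5 4~5)) p₄≤r₁) ]′ 1~2⊎4~5

    3~5 : r v₁ ≤ p R v₃ → v₃ ~ v₅
    3~5 r₁≤p₃ = ~-intro (≺-trans 3≺4 4≺5) (ℚ.≤-trans l₅≤r₁ r₁≤p₃) (ℚ.≤-trans p₅≤r₂ (hi-mono 2≺3))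

  cond3 : Cond3
  cond3 v₁ v₂ v₃ v₄ v₅ 1≺2 2≺3 3≺4 4≺5 1~3 3~5
    with ~-bounds (≺-trans 1≺2 2≺3) 1~3 | ~-bounds (≺-trans 3≺4 4≺5) 3~5
  ... | l₃≤p₁ , p₃≤r₁ | l₅≤p₃ , p₅≤r₃
    with ~-or-r≤p 1≺2 (ℚ.≤-trans (lo-mono 2≺3) l₃≤p₁) | ~-or-p≤l 4≺5 (ℚ.≤-trans p₅≤r₃ (hi-mono 3≺4))
  ... | inj₁ 1~2   | _          = inj₁ 1~2
  ... | inj₂ _     | inj₁ 4~5   = inj₂ (inj₂ 4~5)
  ... | inj₂ r₁≤p₂ | inj₂ p₄≤l₅ = inj₂ (inj₁ (~-intro (≺-trans 2≺3 3≺4)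
    (begin l v₄ ≤⟨ lo-mono 4≺5 ⟩ l v₅ ≤⟨ l₅≤r₁ ⟩ r v₁ ≤⟨ r₁≤p₂ ⟩ p R v₂ ∎)
    (begin p R v₄ ≤⟨ p₄≤l₅ ⟩ l v₅ ≤⟨ l₅≤r₁ ⟩ r v₁ ≤⟨ hi-mono 1≺2 ⟩ r v₂ ∎)))
    where
    l₅≤r₁ : l v₅ ≤ r v₁
    l₅≤r₁ = ℚ.≤-trans l₅≤p₃ p₃≤r₁

  cond4 : Cond4
  cond4 v₁ v₂ vj vk v₅ v₆ 1≺2 2≺j j≺5 5≺6 2≺k k≺5 1~j j~5 2~k k~6
    with ~-bounds (≺-trans 1≺2 2≺j) 1~j | ~-bounds j≺5 j~5 | ~-bounds 2≺k 2~k | ~-bounds (≺-trans k≺5 5≺6) k~6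
  ... | lj≤p₁ , pj≤r₁ | l₅≤pj , _ | _ , pk≤r₂ | l₆≤pk , p₆≤rk
    with ~-or-r≤p 1≺2 (ℚ.≤-trans (lo-mono 2≺j) lj≤p₁) | ~-or-p≤l 5≺6 (ℚ.≤-trans p₆≤rk (hi-mono k≺5))
  ... | inj₁ 1~2   | _          = inj₁ 1~2
  ... | inj₂ _     | inj₁ 5~6   = inj₂ (inj₂ 5~6)
  ... | inj₂ r₁≤p₂ | inj₂ p₅≤l₆ = inj₂ (inj₁ (~-intro (≺-trans 2≺j j≺5)
    (begin l v₅ ≤⟨ l₅≤pj ⟩ p R vj ≤⟨ pj≤r₁ ⟩ r v₁ ≤⟨ r₁≤p₂ ⟩ p R v₂ ∎)
    (begin p R v₅ ≤⟨ p₅≤l₆ ⟩ l v₆ ≤⟨ l₆≤pk ⟩ p R vk ≤⟨ pk≤r₂ ⟩ r v₂ ∎)))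

  allConds : AllConds
  allConds = cond1 , cond2 , cond3 , cond4

lemma3p11 : (n : ℕ) (G : Graph n) → IsProperMPTG G →
    Σ[ L ∈ LinOrd n ] Conditions.AllConds G L
lemma3p11 n G (R , proper) with proper⇒endpointsMonotone R proper
... | L , monotone = L , Sweep.allConds R L monotone
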